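{- For $n\ge1$, the median Genocchi number $H_{2n-1}$ equals the number of excedant functions $f:\{1,2,\ldots,2n-1\}\to\{1,2,\ldots,2n-1\}$ satisfying $f(2k)\le 2n-2$ for $k=1,\ldots,n-1$ and $f(\{1,2,\ldots,2n-1\})=\{2,4,\ldots,2n-2\}\cup\{2n-1\}$.
   Context: A function $f$ is excedant if $f(i)\ge i$ for all $i$. The median Genocchi numbers $H_1,H_3,H_5,H_7,\ldots=1,2,8,56,\ldots$ (OEIS A005439) may be given by $H_{2n-1}=\sum_{k=1}^n(-1)^{n-k}(k!)^2PS_n^{(k)}$, with Legendre–Stirling numbers $PS_0^{(0)}=1$, $PS_n^{(0)}=PS_0^{(k)}=0$ ($n,k\ge1$), $PS_n^{(k)}=PS_{n-1}^{(k-1)}+k(k+1)PS_{n-1}^{(k)}$. -}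

module Defs where

open import Data.Nat as ℕ using (ℕ; zero; suc; _+_; _*_; _∸_; _≤_; _≤?_)
open import Data.Nat.Divisibility using (_∣_; _∣?_)
open import Data.Nat using (_!)
open import Data.Integer as ℤ using (ℤ; +_; -1ℤ)
open import Data.Fin using (Fin; toℕ; _≟_)
open import Data.Fin.Properties using (all?; any?)
open import Data.Vec using (Vec; []; _∷_; lookup)
open import Data.List using (List; [_]; concatMap; map; applyUpTo; foldr; filter; length)
open import Data.List using () renaming (allFin to allFinL)
open import Data.Product using (Σ; ∃; _×_; _,_)
open import Data.Sum using (_⊎_)
open import Relation.Binary.PropositionalEquality using (_≡_)
open import Relation.Nullary using (Dec)
open import Relation.Nullary.Decidable using (_×-dec_; _⊎-dec_; _→-dec_)
open import Data.Nat.Properties using () renaming (_≟_ to _≟ℕ_)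

PS : ℕ → ℕ → ℕ
PS zero zero = 1
PS zero (suc k) = 0
PS (suc n) zero = 0
PS (suc n) (suc k) = PS n k + (suc k * suc (suc k)) * PS n (suc k)

-- H n  denotes the median Genocchi number H_{2n-1}
--   = Σ_{k=1}^{n} (-1)^{n-k} (k!)^2 PS_n^{(k)}
H : ℕ → ℤ
H n = foldr ℤ._+_ (+ 0)
        (applyUpTo (λ i → let k = suc i in
           (-1ℤ ℤ.^ (n ∸ k)) ℤ.* (+ ((k !) * (k !) * PS n k))) n)

allVecs : ∀ {k} (m : ℕ) → List (Vec (Fin k) m)
allVecs zero = [ [] ]
allVecs {k} (suc m) = concatMap (λ x → map (x ∷_) (allVecs m)) (allFinL k)

-- A function f : {1,…,2n-1} → {1,…,2n-1} is represented by a vector v of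
-- length 2n-1 over Fin (2n-1); position i (0-based) is the 1-based point
-- suc (toℕ i), and f(suc (toℕ i)) = suc (toℕ (lookup v i)).
module _ (n : ℕ) where
  m : ℕ
  m = 2 * n ∸ 1

  pt : Fin m → ℕ
  pt i = suc (toℕ i)

  val : Vec (Fin m) m → Fin m → ℕ
  val v i = suc (toℕ (lookup v i))

  Excedant : Vec (Fin m) m → Set
  Excedant v = ∀ i → pt i ≤ val v i

  EvenBound : Vec (Fin m) m → Set
  EvenBound v = ∀ i → 2 ∣ pt i → val v i ≤ 2 * n ∸ 2

  Target : ℕ → Set
  Target j = (2 ∣ j × j ≤ 2 * n ∸ 2) ⊎ j ≡ 2 * n ∸ 1

  ImageIs : Vec (Fin m) m → Set
  ImageIs v = ∀ (j : Fin m) →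
    ((∃ λ i → lookup v i ≡ j) → Target (pt j)) × (Target (pt j) → ∃ λ i → lookup v i ≡ j)

  Good : Vec (Fin m) m → Set
  Good v = Excedant v × EvenBound v × ImageIs v

  target? : ∀ j → Dec (Target j)
  target? j = ((2 ∣? j) ×-dec (j ≤? 2 * n ∸ 2)) ⊎-dec (j ≟ℕ 2 * n ∸ 1)

  good? : ∀ v → Dec (Good v)
  good? v = all? (λ i → pt i ≤? val v i)
      ×-dec all? (λ i → (2 ∣? pt i) →-dec (val v i ≤? 2 * n ∸ 2))
      ×-dec all? (λ j → (any? (λ i → lookup v i ≟ j) →-dec target? (pt j))
                        ×-dec (target? (pt j) →-dec any? (λ i → lookup v i ≟ j)))

  count : ℕ
  count = length (filter good? (allVecs m))

-- Fill in the values of f from the last point 2n − 1 down to the point 1. For the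
-- admissible fillings of a final segment, count those that cover exactly d of the n − 1
-- even targets 2, 4, …, 2n − 2: prepending a point either keeps d (its value is one of
-- the d covered targets, or 2n − 1 if the point is odd) or covers one more target among
-- those still uncovered above it. Alternating odd and even points this is the pair of
-- recurrences evenRow/oddRow, and the count in question is oddRow (n − 1) (n − 1).
-- The binomial transform Σ_d C(i − d, t) · evenRow i d turns that recurrence into the
-- one for (c!)² PS_i^(c) with c + t = i, and binomial inversion recovers the diagonal
-- entry as the alternating sum that defines H_{2n−1}.
module Submission where

open import Level using (Level)
open import Algebra.Bundles using (CommutativeSemiring)
open import Data.Nat as ℕ using (ℕ; zero; suc; _<_; _≤_; s≤s; s≤s⁻¹)
open import Data.Fin as Fin using (Fin; toℕ; fromℕ; inject₁)
import Data.Nat.Properties as ℕₚ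
open import Data.Fin.Properties using (toℕ<n; toℕ-inject₁; toℕ-fromℕ)
open import Relation.Binary.PropositionalEquality as ≡ using (_≡_; refl)
open import Data.List using (foldr; applyUpTo)
open import Defs using (PS; H)

module RangeSum {c ℓ : Level} (R : CommutativeSemiring c ℓ) where

  open CommutativeSemiring R renaming (refl to ≈-refl)
  open import Algebra.Properties.Semiring.Sum semiring public
  open import Relation.Binary.Reasoning.Setoid setoid

  ∑< : ℕ → (ℕ → Carrier) → Carrier
  ∑< n f = ∑[ i < n ] f (toℕ i)

  ∑<-cong : ∀ n {f g : ℕ → Carrier} → (∀ {k} → k < n → f k ≈ g k) → ∑< n f ≈ ∑< n g
  ∑<-cong n f≈g = sum-cong-≋ {n} (λ i → f≈g (toℕ<n i))

  ∑<-distrib-+ : ∀ n (f g : ℕ → Carrier) → ∑< n (λ k → f k + g k) ≈ ∑< n f + ∑< n g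
  ∑<-distrib-+ n f g = ∑-distrib-+ {n} (λ i → f (toℕ i)) (λ i → g (toℕ i))

  *-distribˡ-∑< : ∀ n x (f : ℕ → Carrier) → x * ∑< n f ≈ ∑< n (λ k → x * f k)
  *-distribˡ-∑< n x f = *-distribˡ-sum {n} x (λ i → f (toℕ i))

  *-distribʳ-∑< : ∀ n x (f : ℕ → Carrier) → ∑< n f * x ≈ ∑< n (λ k → f k * x)
  *-distribʳ-∑< n x f = *-distribʳ-sum {n} x (λ i → f (toℕ i))

  ∑<-comm : ∀ m n (f : ℕ → ℕ → Carrier) → ∑< m (λ i → ∑< n (f i)) ≈ ∑< n (λ j → ∑< m (λ i → f i j))
  ∑<-comm m n f = ∑-comm {m} {n} (λ i j → f (toℕ i) (toℕ j))

  ∑<-last : ∀ n (f : ℕ → Carrier) → ∑< (suc n) f ≈ ∑< n f + f n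
  ∑<-last n f = begin
    ∑< (suc n) f                                   ≈⟨ sum-init-last (λ i → f (toℕ i)) ⟩
    ∑[ i < n ] f (toℕ (inject₁ i)) + f (toℕ (fromℕ n))
      ≈⟨ +-cong (sum-cong-≋ {n} (λ i → reflexive (≡.cong f (toℕ-inject₁ i)))) (reflexive (≡.cong f (toℕ-fromℕ n))) ⟩
    ∑< n f + f n                                   ∎

  foldr-applyUpTo : ∀ n (f : ℕ → Carrier) → foldr _+_ 0# (applyUpTo f n) ≡ ∑< n f
  foldr-applyUpTo zero    f = refl
  foldr-applyUpTo (suc n) f = ≡.cong (f 0 +_) (foldr-applyUpTo n (λ k → f (suc k)))

  ∑<-drop-last : ∀ n (f : ℕ → Carrier) → f n ≈ 0# → ∑< (suc n) f ≈ ∑< n f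
  ∑<-drop-last n f fn≈0 = begin
    ∑< (suc n) f   ≈⟨ ∑<-last n f ⟩
    ∑< n f + f n   ≈⟨ +-congˡ fn≈0 ⟩
    ∑< n f + 0#    ≈⟨ +-identityʳ _ ⟩
    ∑< n f         ∎

  ∑<-reverse : ∀ n (f : ℕ → Carrier) → ∑< (suc n) f ≈ ∑< (suc n) (λ k → f (n ℕ.∸ k))
  ∑<-reverse zero f = ≈-refl
  ∑<-reverse (suc n) f = begin
    f 0 + ∑< (suc n) (λ k → f (suc k))           ≈⟨ +-congˡ (∑<-reverse n (λ k → f (suc k))) ⟩
    f 0 + ∑< (suc n) (λ k → f (suc (n ℕ.∸ k)))
      ≈⟨ +-congˡ (∑<-cong (suc n) (λ k<1+n → reflexive (≡.cong f (≡.sym (ℕₚ.+-∸-assoc 1 (s≤s⁻¹ k<1+n)))))) ⟩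
    f 0 + ∑< (suc n) (λ k → f (suc n ℕ.∸ k))     ≈⟨ +-comm _ _ ⟩
    ∑< (suc n) (λ k → f (suc n ℕ.∸ k)) + f 0     ≈⟨ +-congˡ (reflexive (≡.cong f (ℕₚ.n∸n≡0 (suc n)))) ⟨
    ∑< (suc n) (λ k → f (suc n ℕ.∸ k)) + f (suc n ℕ.∸ suc n)  ≈⟨ ∑<-last (suc n) (λ k → f (suc n ℕ.∸ k)) ⟨
    ∑< (suc (suc n)) (λ k → f (suc n ℕ.∸ k))     ∎

module Binomial where

  open import Data.Nat using (_+_; _*_; _∸_; pred)
  open import Data.Nat.Properties
  open import Data.Nat.Combinatorics using (_C_; nC1≡n; k>n⇒nCk≡0; nCk+nC[k+1]≡[n+1]C[k+1])
  open import Data.Nat.Tactic.RingSolver using (solve-∀)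
  open import Relation.Nullary using (yes; no)
  open ≡ using (cong; cong₂; sym; trans; module ≡-Reasoning)
  open ≡-Reasoning

  C-absorption : ∀ k t → suc t * (suc k C suc t) ≡ suc k * (k C t)
  C-absorption zero    zero    = refl
  C-absorption zero    (suc t) = *-zeroʳ (suc (suc t))
  C-absorption (suc k) zero    = trans (*-identityˡ _) (trans (nC1≡n (suc (suc k))) (sym (*-identityʳ (suc (suc k)))))
  C-absorption (suc k) (suc t) = begin
    suc (suc t) * (suc (suc k) C suc (suc t))
      ≡⟨ cong (suc (suc t) *_) (sym (nCk+nC[k+1]≡[n+1]C[k+1] (suc k) (suc t))) ⟩
    suc (suc t) * (suc k C suc t + suc k C suc (suc t))
      ≡⟨ *-distribˡ-+ (suc (suc t)) (suc k C suc t) _ ⟩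
    suc k C suc t + suc t * (suc k C suc t) + suc (suc t) * (suc k C suc (suc t))
      ≡⟨ cong₂ (λ x y → suc k C suc t + x + y) (C-absorption k t) (C-absorption k (suc t)) ⟩
    suc k C suc t + suc k * (k C t) + suc k * (k C suc t)
      ≡⟨ regroup (suc k C suc t) (k C t) (k C suc t) k ⟩
    suc k C suc t + suc k * (k C t + k C suc t)
      ≡⟨ cong (λ x → suc k C suc t + suc k * x) (nCk+nC[k+1]≡[n+1]C[k+1] k t) ⟩
    suc (suc k) * (suc k C suc t) ∎
    where
    regroup : ∀ x y z k → x + suc k * y + suc k * z ≡ x + suc k * (y + z)
    regroup = solve-∀

  C-absorption-∸ : ∀ k t → k * (pred k C t) ≡ (k ∸ t) * (k C t)
  C-absorption-∸ zero    t = cong (_* (0 C t)) (sym (0∸n≡0 t))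
  C-absorption-∸ (suc k) t = begin
    suc k * (k C t)                          ≡⟨ m+n∸n≡m _ (t * (suc k C t)) ⟨
    suc k * (k C t) + t * (suc k C t) ∸ t * (suc k C t)
      ≡⟨ cong (_∸ t * (suc k C t)) (pascal-weighted t) ⟩
    suc k * (suc k C t) ∸ t * (suc k C t)    ≡⟨ *-distribʳ-∸ (suc k C t) (suc k) t ⟨
    (suc k ∸ t) * (suc k C t)                ∎
    where
    pascal-weighted : ∀ t → suc k * (k C t) + t * (suc k C t) ≡ suc k * (suc k C t)
    pascal-weighted zero    = +-identityʳ _
    pascal-weighted (suc t) = begin
      suc k * (k C suc t) + suc t * (suc k C suc t) ≡⟨ cong (suc k * (k C suc t) +_) (C-absorption k t) ⟩
      suc k * (k C suc t) + suc k * (k C t)         ≡⟨ *-distribˡ-+ (suc k) (k C suc t) (k C t) ⟨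
      suc k * (k C suc t + k C t)                   ≡⟨ cong (suc k *_) (+-comm (k C suc t) (k C t)) ⟩
      suc k * (k C t + k C suc t)                   ≡⟨ cong (suc k *_) (nCk+nC[k+1]≡[n+1]C[k+1] k t) ⟩
      suc k * (suc k C suc t)                       ∎

  +-∸-assoc-under-C : ∀ m k t x → (m + (k ∸ t)) * ((k C t) * x) ≡ (m + k ∸ t) * ((k C t) * x)
  +-∸-assoc-under-C m k t x with t ≤? k
  ... | yes t≤k = cong (_* ((k C t) * x)) (sym (+-∸-assoc m t≤k))
  ... | no  t≰k rewrite k>n⇒nCk≡0 (≰⇒> t≰k) = trans (*-zeroʳ (m + (k ∸ t))) (sym (*-zeroʳ (m + k ∸ t)))

module Rows where

  open import Data.Nat using (_+_; _*_; _∸_)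
  open import Data.Nat.Properties
  open import Data.Nat.Tactic.RingSolver using (solve-∀)
  open ≡ using (cong; cong₂; module ≡-Reasoning)
  open ≡-Reasoning

  -- If f d counts the fillings of a segment that cover d targets, extendRow e a f d counts
  -- them after prepending a point with a targets at or above it: the new value either keeps
  -- the number of covered targets (one of the d covered ones, or the top value when e = 1)
  -- or covers one of the a − (d − 1) targets still free.
  coverNew : ℕ → (ℕ → ℕ) → ℕ → ℕ
  coverNew a f zero    = 0
  coverNew a f (suc d) = (a ∸ d) * f d

  extendRow : ℕ → ℕ → (ℕ → ℕ) → ℕ → ℕ
  extendRow e a f d = (e + d) * f d + coverNew a f d

  extendRow-cong : ∀ e a {f g : ℕ → ℕ} → (∀ d → f d ≡ g d) → ∀ d → extendRow e a f d ≡ extendRow e a g d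
  extendRow-cong e a f≗g zero    = cong (λ x → (e + 0) * x + 0) (f≗g 0)
  extendRow-cong e a f≗g (suc d) = cong₂ (λ x y → (e + suc d) * x + (a ∸ d) * y) (f≗g (suc d)) (f≗g d)

  extendRow-* : ∀ e a c f d → extendRow e a (λ d → c * f d) d ≡ c * extendRow e a f d
  extendRow-* e a c f zero    = linear (e + 0) c (f 0)
    where
    linear : ∀ m c x → m * (c * x) + 0 ≡ c * (m * x + 0)
    linear = solve-∀
  extendRow-* e a c f (suc d) = linear (e + suc d) (a ∸ d) c (f (suc d)) (f d)
    where
    linear : ∀ m m′ c x x′ → m * (c * x) + m′ * (c * x′) ≡ c * (m * x + m′ * x′)
    linear = solve-∀

  extendRow-vanishes : ∀ e {a b} f → a ≤ b → (∀ {d} → b < d → f d ≡ 0) →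
    ∀ {d} → b < d → extendRow e a f d ≡ 0
  extendRow-vanishes e {a} f a≤b f-vanishes {suc d} b<1+d = begin
    (e + suc d) * f (suc d) + (a ∸ d) * f d
      ≡⟨ cong₂ (λ x y → (e + suc d) * x + y * f d) (f-vanishes b<1+d) (m≤n⇒m∸n≡0 (≤-trans a≤b (s≤s⁻¹ b<1+d))) ⟩
    (e + suc d) * 0 + 0
      ≡⟨ cong (_+ 0) (*-zeroʳ (e + suc d)) ⟩
    0 ∎

  -- evenRow i d (oddRow i d) counts the admissible fillings of the last 2i (2i + 1)
  -- points that cover exactly d even targets.
  evenRow oddRow : ℕ → ℕ → ℕ
  evenRow zero    zero    = 1
  evenRow zero    (suc d) = 0
  evenRow (suc i)         = extendRow 0 (suc i) (oddRow i)
  oddRow i                = extendRow 1 i (evenRow i)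

  evenRow-vanishes : ∀ i {d} → i < d → evenRow i d ≡ 0
  oddRow-vanishes  : ∀ i {d} → i < d → oddRow i d ≡ 0
  evenRow-vanishes zero    {suc d} _ = refl
  evenRow-vanishes (suc i)         = extendRow-vanishes 0 (oddRow i) ≤-refl (λ 1+i<d → oddRow-vanishes i (<-trans (n<1+n i) 1+i<d))
  oddRow-vanishes  i               = extendRow-vanishes 1 (evenRow i) ≤-refl (evenRow-vanishes i)

  evenRow-diagonal : ∀ i → evenRow (suc i) (suc i) ≡ oddRow i i
  evenRow-diagonal i = begin
    suc i * oddRow i (suc i) + (suc i ∸ i) * oddRow i i
      ≡⟨ cong₂ (λ x y → suc i * x + y * oddRow i i) (oddRow-vanishes i ≤-refl) (m+n∸n≡m 1 i) ⟩
    suc i * 0 + 1 * oddRow i i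
      ≡⟨ cong₂ _+_ (*-zeroʳ (suc i)) (*-identityˡ (oddRow i i)) ⟩
    oddRow i i ∎

module BinomialTransform where

  open import Data.Nat using (_+_; _*_; _∸_; pred; _!)
  open import Data.Nat.Properties
  open import Data.Nat.Combinatorics using (_C_; nCk+nC[k+1]≡[n+1]C[k+1])
  open import Data.Nat.Tactic.RingSolver using (solve-∀)
  open ≡ using (cong; cong₂; sym; trans; module ≡-Reasoning)
  open ≡-Reasoning
  open RangeSum +-*-commutativeSemiring
  open Binomial
  open Rows

  binomialTransform : ℕ → (ℕ → ℕ) → ℕ → ℕ
  binomialTransform a f t = ∑< (suc a) (λ d → ((a ∸ d) C t) * f d)

  extendRow-term : ∀ e d k t x →
    (k C t) * ((e + d) * x) + (pred k C t) * (k * x) ≡ (k + d + e ∸ t) * ((k C t) * x)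
  extendRow-term e d k t x = begin
    (k C t) * ((e + d) * x) + (pred k C t) * (k * x)
      ≡⟨ regroup (k C t) (pred k C t) (e + d) k x ⟩
    (e + d) * ((k C t) * x) + (k * (pred k C t)) * x
      ≡⟨ cong (λ y → (e + d) * ((k C t) * x) + y * x) (C-absorption-∸ k t) ⟩
    (e + d) * ((k C t) * x) + ((k ∸ t) * (k C t)) * x
      ≡⟨ factor (k C t) (e + d) (k ∸ t) x ⟩
    (e + d + (k ∸ t)) * ((k C t) * x)
      ≡⟨ +-∸-assoc-under-C (e + d) k t x ⟩
    (e + d + k ∸ t) * ((k C t) * x)
      ≡⟨ cong (λ y → (y ∸ t) * ((k C t) * x)) (shuffle e d k) ⟩
    (k + d + e ∸ t) * ((k C t) * x) ∎
    where
    regroup : ∀ c c′ m k x → c * (m * x) + c′ * (k * x) ≡ m * (c * x) + (k * c′) * x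
    regroup = solve-∀
    factor : ∀ c m j x → m * (c * x) + (j * c) * x ≡ (m + j) * (c * x)
    factor = solve-∀
    shuffle : ∀ e d k → e + d + k ≡ k + d + e
    shuffle = solve-∀

  binomialTransform-extendRow : ∀ e a f t →
    binomialTransform a (extendRow e a f) t ≡ (a + e ∸ t) * binomialTransform a f t
  binomialTransform-extendRow e a f t = begin
    ∑< (suc a) (λ d → ((a ∸ d) C t) * ((e + d) * f d + coverNew a f d))
      ≡⟨ ∑<-cong (suc a) (λ {d} _ → *-distribˡ-+ ((a ∸ d) C t) ((e + d) * f d) (coverNew a f d)) ⟩
    ∑< (suc a) (λ d → ((a ∸ d) C t) * ((e + d) * f d) + ((a ∸ d) C t) * coverNew a f d)
      ≡⟨ ∑<-distrib-+ (suc a) kept new ⟩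
    ∑< (suc a) kept + ∑< (suc a) new
      ≡⟨ cong (∑< (suc a) kept +_) new-shifted ⟩
    ∑< (suc a) kept + ∑< (suc a) new′
      ≡⟨ ∑<-distrib-+ (suc a) kept new′ ⟨
    ∑< (suc a) (λ d → kept d + new′ d)
      ≡⟨ ∑<-cong (suc a) (λ {d} d<1+a → combine d (s≤s⁻¹ d<1+a)) ⟩
    ∑< (suc a) (λ d → (a + e ∸ t) * (((a ∸ d) C t) * f d))
      ≡⟨ *-distribˡ-∑< (suc a) (a + e ∸ t) (λ d → ((a ∸ d) C t) * f d) ⟨
    (a + e ∸ t) * binomialTransform a f t ∎
    where
    kept new new′ : ℕ → ℕ
    kept d = ((a ∸ d) C t) * ((e + d) * f d)
    new  d = ((a ∸ d) C t) * coverNew a f d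
    new′ d = (pred (a ∸ d) C t) * ((a ∸ d) * f d)
    new-shifted : ∑< (suc a) new ≡ ∑< (suc a) new′
    new-shifted = begin
      (a C t) * 0 + ∑< a (λ d → ((a ∸ suc d) C t) * ((a ∸ d) * f d))
        ≡⟨ cong (_+ ∑< a (λ d → new (suc d))) (*-zeroʳ (a C t)) ⟩
      ∑< a (λ d → ((a ∸ suc d) C t) * ((a ∸ d) * f d))
        ≡⟨ ∑<-cong a (λ {d} _ → cong (λ k → (k C t) * ((a ∸ d) * f d)) (pred[m∸n]≡m∸[1+n] a d)) ⟨
      ∑< a new′
        ≡⟨ +-identityʳ _ ⟨
      ∑< a new′ + 0
        ≡⟨ cong (∑< a new′ +_) (top-vanishes (a ∸ a) (n∸n≡0 a)) ⟨
      ∑< a new′ + new′ a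
        ≡⟨ ∑<-last a new′ ⟨
      ∑< (suc a) new′ ∎
      where
      top-vanishes : ∀ k → k ≡ 0 → (pred k C t) * (k * f a) ≡ 0
      top-vanishes _ refl = *-zeroʳ (0 C t)
    combine : ∀ d → d ≤ a → kept d + new′ d ≡ (a + e ∸ t) * (((a ∸ d) C t) * f d)
    combine d d≤a = trans (extendRow-term e d (a ∸ d) t (f d))
      (cong (λ y → (y + e ∸ t) * (((a ∸ d) C t) * f d)) (m∸n+n≡m d≤a))

  binomialTransform-drop₀ : ∀ a f → f (suc a) ≡ 0 → binomialTransform (suc a) f 0 ≡ binomialTransform a f 0
  binomialTransform-drop₀ a f fa≡0 = ∑<-drop-last (suc a) (λ d → 1 * f d) (cong (1 *_) fa≡0)

  binomialTransform-pascal : ∀ a f → f (suc a) ≡ 0 → ∀ t →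
    binomialTransform (suc a) f (suc t) ≡ binomialTransform a f t + binomialTransform a f (suc t)
  binomialTransform-pascal a f fa≡0 t = begin
    ∑< (suc (suc a)) (λ d → ((suc a ∸ d) C suc t) * f d)
      ≡⟨ ∑<-drop-last (suc a) (λ d → ((suc a ∸ d) C suc t) * f d) (trans (cong (last-C *_) fa≡0) (*-zeroʳ last-C)) ⟩
    ∑< (suc a) (λ d → ((suc a ∸ d) C suc t) * f d)
      ≡⟨ ∑<-cong (suc a) (λ d<1+a → split (s≤s⁻¹ d<1+a)) ⟩
    ∑< (suc a) (λ d → ((a ∸ d) C t) * f d + ((a ∸ d) C suc t) * f d)
      ≡⟨ ∑<-distrib-+ (suc a) (λ d → ((a ∸ d) C t) * f d) (λ d → ((a ∸ d) C suc t) * f d) ⟩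
    binomialTransform a f t + binomialTransform a f (suc t) ∎
    where
    last-C : ℕ
    last-C = (suc a ∸ suc a) C suc t
    split : ∀ {d} → d ≤ a → ((suc a ∸ d) C suc t) * f d ≡ ((a ∸ d) C t) * f d + ((a ∸ d) C suc t) * f d
    split {d} d≤a = begin
      ((suc a ∸ d) C suc t) * f d                  ≡⟨ cong (λ k → (k C suc t) * f d) (+-∸-assoc 1 d≤a) ⟩
      (suc (a ∸ d) C suc t) * f d                  ≡⟨ cong (_* f d) (nCk+nC[k+1]≡[n+1]C[k+1] (a ∸ d) t) ⟨
      ((a ∸ d) C t + (a ∸ d) C suc t) * f d        ≡⟨ *-distribʳ-+ (f d) ((a ∸ d) C t) _ ⟩
      ((a ∸ d) C t) * f d + ((a ∸ d) C suc t) * f d ∎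

  PS-vanishes : ∀ {n k} → n < k → PS n k ≡ 0
  PS-vanishes {zero}  {suc k} _ = refl
  PS-vanishes {suc n} {suc k} (s≤s n<k)
    rewrite PS-vanishes n<k | PS-vanishes (<-trans n<k (n<1+n k)) = *-zeroʳ (suc k * suc (suc k))

  m+n+o∸n≡m+o : ∀ c t e → c + t + e ∸ t ≡ c + e
  m+n+o∸n≡m+o c t e = trans (cong (_∸ t) (reorder c t e)) (m+n∸n≡m (c + e) t)
    where
    reorder : ∀ c t e → c + t + e ≡ c + e + t
    reorder = solve-∀

  binomialTransform-evenRow : ∀ c t {i} → c + t ≡ i → binomialTransform i (evenRow i) t ≡ c ! * c ! * PS i c
  binomialTransform-oddRow  : ∀ c t {i} → c + t ≡ i → binomialTransform i (oddRow i) t ≡ c ! * suc c ! * PS i c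

  binomialTransform-oddRow c t refl = begin
    binomialTransform (c + t) (oddRow (c + t)) t
      ≡⟨ binomialTransform-extendRow 1 (c + t) (evenRow (c + t)) t ⟩
    (c + t + 1 ∸ t) * binomialTransform (c + t) (evenRow (c + t)) t
      ≡⟨ cong₂ _*_ (m+n+o∸n≡m+o c t 1) (binomialTransform-evenRow c t refl) ⟩
    (c + 1) * (c ! * c ! * PS (c + t) c)
      ≡⟨ absorb (c !) (PS (c + t) c) c ⟩
    c ! * suc c ! * PS (c + t) c ∎
    where
    absorb : ∀ f p c → (c + 1) * (f * f * p) ≡ f * (suc c * f) * p
    absorb = solve-∀

  binomialTransform-evenRow zero zero refl = refl
  binomialTransform-evenRow zero (suc t) refl =
    trans (binomialTransform-extendRow 0 (suc t) (oddRow t) (suc t))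
          (cong (_* binomialTransform (suc t) (oddRow t) (suc t)) (m+n+o∸n≡m+o 0 (suc t) 0))
  binomialTransform-evenRow (suc c) zero refl = begin
    binomialTransform (suc i) (extendRow 0 (suc i) (oddRow i)) 0
      ≡⟨ binomialTransform-extendRow 0 (suc i) (oddRow i) 0 ⟩
    (suc i + 0) * binomialTransform (suc i) (oddRow i) 0
      ≡⟨ cong ((suc i + 0) *_) (binomialTransform-drop₀ i (oddRow i) (oddRow-vanishes i ≤-refl)) ⟩
    (suc i + 0) * binomialTransform i (oddRow i) 0
      ≡⟨ cong ((suc i + 0) *_) (binomialTransform-oddRow c 0 refl) ⟩
    (suc i + 0) * (c ! * suc c ! * PS i c)
      ≡⟨ legendre-stirling-top (c !) (PS i c) c ⟩
    suc c ! * suc c ! * (PS i c + (suc c * suc (suc c)) * 0)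
      ≡⟨ cong (λ q → suc c ! * suc c ! * (PS i c + (suc c * suc (suc c)) * q)) (PS-vanishes (s≤s (≤-reflexive (+-identityʳ c)))) ⟨
    suc c ! * suc c ! * PS (suc i) (suc c) ∎
    where
    i : ℕ
    i = c + 0
    legendre-stirling-top : ∀ f p c →
      (suc (c + 0) + 0) * (f * (suc c * f) * p) ≡ (suc c * f) * (suc c * f) * (p + (suc c * suc (suc c)) * 0)
    legendre-stirling-top = solve-∀
  binomialTransform-evenRow (suc c) (suc t) refl = begin
    binomialTransform (suc i) (extendRow 0 (suc i) (oddRow i)) (suc t)
      ≡⟨ binomialTransform-extendRow 0 (suc i) (oddRow i) (suc t) ⟩
    (suc c + suc t + 0 ∸ suc t) * binomialTransform (suc i) (oddRow i) (suc t)
      ≡⟨ cong₂ _*_ (m+n+o∸n≡m+o (suc c) (suc t) 0) (binomialTransform-pascal i (oddRow i) (oddRow-vanishes i ≤-refl) t) ⟩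
    (suc c + 0) * (binomialTransform i (oddRow i) t + binomialTransform i (oddRow i) (suc t))
      ≡⟨ cong (λ x → (suc c + 0) * (x + binomialTransform i (oddRow i) (suc t))) (binomialTransform-oddRow (suc c) t (sym (+-suc c t))) ⟩
    (suc c + 0) * (suc c ! * suc (suc c) ! * PS i (suc c) + binomialTransform i (oddRow i) (suc t))
      ≡⟨ cong (λ x → (suc c + 0) * (suc c ! * suc (suc c) ! * PS i (suc c) + x)) (binomialTransform-oddRow c (suc t) refl) ⟩
    (suc c + 0) * (suc c ! * suc (suc c) ! * PS i (suc c) + c ! * suc c ! * PS i c)
      ≡⟨ legendre-stirling-step (c !) (PS i c) (PS i (suc c)) c ⟩
    suc c ! * suc c ! * PS (suc i) (suc c) ∎
    where
    i : ℕ
    i = c + suc t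
    legendre-stirling-step : ∀ f p q c →
      (suc c + 0) * ((suc c * f) * (suc (suc c) * (suc c * f)) * q + f * (suc c * f) * p)
        ≡ (suc c * f) * (suc c * f) * (p + (suc c * suc (suc c)) * q)
    legendre-stirling-step = solve-∀

module Inversion where

  open import Data.Nat using (_∸_; _!)
  open import Data.Nat.Combinatorics using (_C_; k>n⇒nCk≡0; nCk+nC[k+1]≡[n+1]C[k+1])
  open import Data.Integer using (ℤ; +_; -1ℤ; _+_; _*_; _^_)
  open import Data.Integer.Properties
  open import Data.Integer.Tactic.RingSolver using (solve-∀)
  open ≡ using (cong; cong₂; sym; trans; module ≡-Reasoning)
  open ≡-Reasoning
  open RangeSum +-*-commutativeSemiring
  module ℕΣ = RangeSum ℕₚ.+-*-commutativeSemiring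
  open BinomialTransform using (binomialTransform; binomialTransform-evenRow)

  sign : ℕ → ℤ
  sign t = -1ℤ ^ t

  pos-∑< : ∀ n (f : ℕ → ℕ) → + ℕΣ.∑< n f ≡ ∑< n (λ k → + f k)
  pos-∑< zero    f = refl
  pos-∑< (suc n) f = trans (pos-+ (f 0) _) (cong (λ x → + f 0 + x) (pos-∑< n (λ k → f (suc k))))

  alternating-C-telescopes : ∀ k m → ∑< (suc m) (λ t → sign t * + (suc k C t)) ≡ sign m * + (k C m)
  alternating-C-telescopes k zero    = refl
  alternating-C-telescopes k (suc m) = begin
    ∑< (suc (suc m)) (λ t → sign t * + (suc k C t))
      ≡⟨ ∑<-last (suc m) (λ t → sign t * + (suc k C t)) ⟩
    ∑< (suc m) (λ t → sign t * + (suc k C t)) + sign (suc m) * + (suc k C suc m)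
      ≡⟨ cong₂ (λ x y → x + sign (suc m) * + y) (alternating-C-telescopes k m) (sym (nCk+nC[k+1]≡[n+1]C[k+1] k m)) ⟩
    sign m * + (k C m) + sign (suc m) * + (k C m ℕ.+ k C suc m)
      ≡⟨ cong (λ x → sign m * + (k C m) + sign (suc m) * x) (pos-+ (k C m) (k C suc m)) ⟩
    sign m * + (k C m) + -1ℤ * sign m * (+ (k C m) + + (k C suc m))
      ≡⟨ cancel (sign m) (+ (k C m)) (+ (k C suc m)) ⟩
    sign (suc m) * + (k C suc m) ∎
    where
    cancel : ∀ s x y → s * x + -1ℤ * s * (x + y) ≡ -1ℤ * s * y
    cancel = solve-∀

  alternating-C-vanishes : ∀ {k m} → k < m → ∑< (suc m) (λ t → sign t * + (suc k C t)) ≡ + 0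
  alternating-C-vanishes {k} {m} k<m = begin
    ∑< (suc m) (λ t → sign t * + (suc k C t))   ≡⟨ alternating-C-telescopes k m ⟩
    sign m * + (k C m)                         ≡⟨ cong (λ x → sign m * + x) (k>n⇒nCk≡0 k<m) ⟩
    sign m * + 0                               ≡⟨ *-zeroʳ (sign m) ⟩
    + 0                                        ∎

  alternating-C-zero : ∀ m → ∑< (suc m) (λ t → sign t * + (0 C t)) ≡ + 1
  alternating-C-zero m = cong (λ x → + 1 + x) (begin
    ∑< m (λ t → sign (suc t) * + 0)   ≡⟨ ∑<-cong m (λ {t} _ → *-zeroʳ (sign (suc t))) ⟩
    ∑< m (λ _ → + 0)                  ≡⟨ sum-replicate-zero m ⟩
    + 0                               ∎)

  binomial-inversion : ∀ a f → ∑< (suc a) (λ t → sign t * + binomialTransform a f t) ≡ + f a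
  binomial-inversion a f = begin
    ∑< (suc a) (λ t → sign t * + ℕΣ.∑< (suc a) (λ d → term t d))
      ≡⟨ ∑<-cong (suc a) (λ {t} _ → cong (sign t *_) (pos-∑< (suc a) (term t))) ⟩
    ∑< (suc a) (λ t → sign t * ∑< (suc a) (λ d → + term t d))
      ≡⟨ ∑<-cong (suc a) (λ {t} _ → *-distribˡ-∑< (suc a) (sign t) (λ d → + term t d)) ⟩
    ∑< (suc a) (λ t → ∑< (suc a) (λ d → sign t * + term t d))
      ≡⟨ ∑<-comm (suc a) (suc a) (λ t d → sign t * + term t d) ⟩
    ∑< (suc a) (λ d → ∑< (suc a) (λ t → sign t * + term t d))
      ≡⟨ ∑<-cong (suc a) (λ {d} _ → pull-out d) ⟩
    ∑< (suc a) (λ d → + f d * alternating (a ∸ d))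
      ≡⟨ ∑<-last a (λ d → + f d * alternating (a ∸ d)) ⟩
    ∑< a (λ d → + f d * alternating (a ∸ d)) + + f a * alternating (a ∸ a)
      ≡⟨ cong₂ _+_ (∑<-cong a below-diagonal) (cong (λ k → + f a * alternating k) (ℕₚ.n∸n≡0 a)) ⟩
    ∑< a (λ _ → + 0) + + f a * alternating 0
      ≡⟨ cong₂ _+_ (sum-replicate-zero a) (cong (+ f a *_) (alternating-C-zero a)) ⟩
    + 0 + + f a * + 1
      ≡⟨ trans (+-identityˡ _) (*-identityʳ (+ f a)) ⟩
    + f a ∎
    where
    term : ℕ → ℕ → ℕ
    term t d = ((a ∸ d) C t) ℕ.* f d
    alternating : ℕ → ℤ
    alternating k = ∑< (suc a) (λ t → sign t * + (k C t))
    pull-out : ∀ d → ∑< (suc a) (λ t → sign t * + term t d) ≡ + f d * alternating (a ∸ d)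
    pull-out d = begin
      ∑< (suc a) (λ t → sign t * + term t d)
        ≡⟨ ∑<-cong (suc a) (λ {t} _ → trans (cong (sign t *_) (pos-* ((a ∸ d) C t) (f d))) (swap (sign t) (+ ((a ∸ d) C t)) (+ f d))) ⟩
      ∑< (suc a) (λ t → + f d * (sign t * + ((a ∸ d) C t)))
        ≡⟨ *-distribˡ-∑< (suc a) (+ f d) (λ t → sign t * + ((a ∸ d) C t)) ⟨
      + f d * alternating (a ∸ d) ∎
      where
      swap : ∀ s x y → s * (x * y) ≡ y * (s * x)
      swap = solve-∀
    below-diagonal : ∀ {d} → d < a → + f d * alternating (a ∸ d) ≡ + 0
    below-diagonal {d} d<a = begin
      + f d * alternating (a ∸ d)               ≡⟨ cong (λ k → + f d * alternating k) a∸d≡1+k ⟩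
      + f d * alternating (suc (a ∸ suc d))     ≡⟨ cong (+ f d *_) (alternating-C-vanishes k<a) ⟩
      + f d * + 0                               ≡⟨ *-zeroʳ (+ f d) ⟩
      + 0                                       ∎
      where
      a∸d≡1+k : a ∸ d ≡ suc (a ∸ suc d)
      a∸d≡1+k = ℕₚ.+-∸-assoc 1 d<a
      k<a : a ∸ suc d < a
      k<a = ≡.subst (ℕ._≤ a) a∸d≡1+k (ℕₚ.m∸n≤m a d)

  open Rows using (evenRow; oddRow; evenRow-diagonal)

  oddRow-diagonal≡H : ∀ N → + oddRow N N ≡ H (suc N)
  oddRow-diagonal≡H N = begin
    + oddRow N N
      ≡⟨ cong +_ (evenRow-diagonal N) ⟨
    + evenRow n n
      ≡⟨ binomial-inversion n (evenRow n) ⟨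
    ∑< (suc n) (λ t → sign t * + binomialTransform n (evenRow n) t)
      ≡⟨ ∑<-cong (suc n) (λ {t} t<1+n → cong (λ x → sign t * + x) (binomialTransform-evenRow (n ∸ t) t (ℕₚ.m∸n+n≡m (s≤s⁻¹ t<1+n)))) ⟩
    ∑< (suc n) (λ t → sign t * + weighted (n ∸ t))
      ≡⟨ ∑<-reverse n (λ t → sign t * + weighted (n ∸ t)) ⟩
    ∑< (suc n) (λ c → sign (n ∸ c) * + weighted (n ∸ (n ∸ c)))
      ≡⟨ ∑<-cong (suc n) (λ {c} c<1+n → cong (λ x → sign (n ∸ c) * + weighted x) (ℕₚ.m∸[m∸n]≡n (s≤s⁻¹ c<1+n))) ⟩
    -- the c = 0 term is sign n * + (0! * 0! * PS n 0), and PS n 0 = 0 as n ≥ 1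
    sign n * + 0 + ∑< n (λ c → sign (n ∸ suc c) * + weighted (suc c))
      ≡⟨ cong (_+ ∑< n (λ c → sign (n ∸ suc c) * + weighted (suc c))) (*-zeroʳ (sign n)) ⟩
    + 0 + ∑< n (λ c → sign (n ∸ suc c) * + weighted (suc c))
      ≡⟨ +-identityˡ _ ⟩
    ∑< n (λ c → sign (n ∸ suc c) * + weighted (suc c))
      ≡⟨ foldr-applyUpTo n (λ c → sign (n ∸ suc c) * + weighted (suc c)) ⟨
    H n ∎
    where
    n : ℕ
    n = suc N
    weighted : ℕ → ℕ
    weighted c = c ! ℕ.* c ! ℕ.* PS n c

module Counting where

  open import Data.Bool using (Bool; true; false; _∧_; not; T)
  open import Data.Empty using (⊥; ⊥-elim)
  open import Data.Nat using (_+_; _*_; _≡ᵇ_)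
  open import Data.Nat.Properties
  open import Data.Vec using (Vec; []; _∷_)
  open import Data.List using (List; []; _∷_; _++_; map; concat; length; filter; tabulate)
  open import Data.List.Properties using (filter-++; length-++; map-tabulate)
  open import Relation.Nullary using (does)
  open import Relation.Unary using (Pred; Decidable)
  open import Defs using (allVecs)
  open ≡ using (cong; sym; trans; module ≡-Reasoning)
  open ≡-Reasoning
  open RangeSum +-*-commutativeSemiring

  𝟙 : Bool → ℕ
  𝟙 true  = 1
  𝟙 false = 0

  𝟙-split : ∀ b c → 𝟙 b ≡ 𝟙 (b ∧ c) + 𝟙 (b ∧ not c)
  𝟙-split false c     = refl
  𝟙-split true  true  = refl
  𝟙-split true  false = refl

  𝟙-true : ∀ {b} → T b → 𝟙 b ≡ 1
  𝟙-true {true} _ = refl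

  𝟙-false : ∀ {b} → (T b → ⊥) → 𝟙 b ≡ 0
  𝟙-false {false} _  = refl
  𝟙-false {true}  ¬b = ⊥-elim (¬b _)

  𝟙-∧ : ∀ a b → 𝟙 (a ∧ b) ≡ 𝟙 a * 𝟙 b
  𝟙-∧ false b = refl
  𝟙-∧ true  b = sym (+-identityʳ (𝟙 b))

  𝟙-*-cong : ∀ b {x y} → (T b → x ≡ y) → 𝟙 b * x ≡ 𝟙 b * y
  𝟙-*-cong false _   = refl
  𝟙-*-cong true  x≡y = cong (1 *_) (x≡y _)

  ∑<-vanishing-terms : ∀ n (f : ℕ → ℕ) → ∑< n f ≡ 0 → ∀ {k} → k < n → f k ≡ 0
  ∑<-vanishing-terms (suc n) f ∑≡0 {zero}  _         = m+n≡0⇒m≡0 (f 0) ∑≡0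
  ∑<-vanishing-terms (suc n) f ∑≡0 {suc k} (s≤s k<n) = ∑<-vanishing-terms n (λ j → f (suc j)) (m+n≡0⇒n≡0 (f 0) ∑≡0) k<n

  𝟙≡ᵇ-transport : ∀ y x (F : ℕ → ℕ) → 𝟙 (y ≡ᵇ x) * F y ≡ 𝟙 (y ≡ᵇ x) * F x
  𝟙≡ᵇ-transport zero    zero    F = refl
  𝟙≡ᵇ-transport zero    (suc x) F = refl
  𝟙≡ᵇ-transport (suc y) zero    F = refl
  𝟙≡ᵇ-transport (suc y) (suc x) F = 𝟙≡ᵇ-transport y x (λ k → F (suc k))

  ∑<-𝟙≡ᵇ : ∀ {n x} → x < n → ∀ (F : ℕ → ℕ) → ∑< n (λ y → 𝟙 (y ≡ᵇ x) * F y) ≡ F x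
  ∑<-𝟙≡ᵇ {suc n} {zero}  _         F =
    trans (cong (F 0 + 0 +_) (sum-replicate-zero n)) (trans (+-identityʳ _) (+-identityʳ (F 0)))
  ∑<-𝟙≡ᵇ {suc n} {suc x} (s≤s x<n) F = ∑<-𝟙≡ᵇ x<n (λ k → F (suc k))

  length-filter-map : ∀ {a b p} {A : Set a} {B : Set b} {P : Pred B p} (P? : Decidable P) (f : A → B) xs →
    length (filter P? (map f xs)) ≡ length (filter (λ x → P? (f x)) xs)
  length-filter-map P? f []       = refl
  length-filter-map P? f (x ∷ xs) with does (P? (f x))
  ... | true  = cong suc (length-filter-map P? f xs)
  ... | false = length-filter-map P? f xs

  length-filter-concat-tabulate : ∀ {a p} {A : Set a} {P : Pred A p} (P? : Decidable P) {m} (h : Fin m → List A) →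
    length (filter P? (concat (tabulate h))) ≡ ∑[ x < m ] length (filter P? (h x))
  length-filter-concat-tabulate P? {zero}  h = refl
  length-filter-concat-tabulate P? {suc m} h = begin
    length (filter P? (h Fin.zero ++ concat (tabulate (λ x → h (Fin.suc x)))))
      ≡⟨ cong length (filter-++ P? (h Fin.zero) _) ⟩
    length (filter P? (h Fin.zero) ++ filter P? (concat (tabulate (λ x → h (Fin.suc x)))))
      ≡⟨ length-++ (filter P? (h Fin.zero)) ⟩
    length (filter P? (h Fin.zero)) + length (filter P? (concat (tabulate (λ x → h (Fin.suc x)))))
      ≡⟨ cong (length (filter P? (h Fin.zero)) +_) (length-filter-concat-tabulate P? (λ x → h (Fin.suc x))) ⟩
    ∑[ x < suc m ] length (filter P? (h x)) ∎

  module _ {M : ℕ} where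

    ∑ᵥ : ∀ k → (Vec (Fin M) k → ℕ) → ℕ
    ∑ᵥ zero    w = w []
    ∑ᵥ (suc k) w = ∑[ x < M ] ∑ᵥ k (λ s → w (x ∷ s))

    ∑ᵥ-cong : ∀ k {w w′ : Vec (Fin M) k → ℕ} → (∀ s → w s ≡ w′ s) → ∑ᵥ k w ≡ ∑ᵥ k w′
    ∑ᵥ-cong zero    w≗w′ = w≗w′ []
    ∑ᵥ-cong (suc k) w≗w′ = sum-cong-≗ {M} (λ x → ∑ᵥ-cong k (λ s → w≗w′ (x ∷ s)))

    ∑ᵥ-distrib-+ : ∀ k (w w′ : Vec (Fin M) k → ℕ) → ∑ᵥ k (λ s → w s + w′ s) ≡ ∑ᵥ k w + ∑ᵥ k w′
    ∑ᵥ-distrib-+ zero    w w′ = refl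
    ∑ᵥ-distrib-+ (suc k) w w′ = trans (sum-cong-≗ {M} (λ x → ∑ᵥ-distrib-+ k (λ s → w (x ∷ s)) (λ s → w′ (x ∷ s))))
      (∑-distrib-+ {M} (λ x → ∑ᵥ k (λ s → w (x ∷ s))) (λ x → ∑ᵥ k (λ s → w′ (x ∷ s))))

    ∑ᵥ-distribˡ-* : ∀ k c (w : Vec (Fin M) k → ℕ) → ∑ᵥ k (λ s → c * w s) ≡ c * ∑ᵥ k w
    ∑ᵥ-distribˡ-* zero    c w = refl
    ∑ᵥ-distribˡ-* (suc k) c w = trans (sum-cong-≗ {M} (λ x → ∑ᵥ-distribˡ-* k c (λ s → w (x ∷ s))))
      (sym (*-distribˡ-sum {M} c (λ x → ∑ᵥ k (λ s → w (x ∷ s)))))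

    ∑ᵥ-comm : ∀ k {m} (f : Fin m → Vec (Fin M) k → ℕ) →
      ∑ᵥ k (λ s → ∑[ x < m ] f x s) ≡ ∑[ x < m ] ∑ᵥ k (f x)
    ∑ᵥ-comm zero    f = refl
    ∑ᵥ-comm (suc k) f = trans (sum-cong-≗ {M} (λ y → ∑ᵥ-comm k (λ x s → f x (y ∷ s))))
      (∑-comm (λ y x → ∑ᵥ k (λ s → f x (y ∷ s))))

    length-filter-allVecs : ∀ k {p} {P : Pred (Vec (Fin M) k) p} (P? : Decidable P) →
      length (filter P? (allVecs k)) ≡ ∑ᵥ k (λ v → 𝟙 (does (P? v)))
    length-filter-allVecs zero    P? with does (P? [])
    ... | true  = refl
    ... | false = refl
    length-filter-allVecs (suc k) P? = begin
      length (filter P? (concat (map row (tabulate (λ x → x)))))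
        ≡⟨ cong (λ xss → length (filter P? (concat xss))) (map-tabulate (λ x → x) row) ⟩
      length (filter P? (concat (tabulate row)))
        ≡⟨ length-filter-concat-tabulate P? row ⟩
      ∑[ x < M ] length (filter P? (row x))
        ≡⟨ sum-cong-≗ {M} (λ x → trans (length-filter-map P? (x ∷_) (allVecs k)) (length-filter-allVecs k (λ s → P? (x ∷ s)))) ⟩
      ∑ᵥ (suc k) (λ v → 𝟙 (does (P? v))) ∎
      where
      row : Fin M → List (Vec (Fin M) (suc k))
      row x = map (x ∷_) (allVecs k)

module Parity where

  open import Data.Bool using (Bool; true; false; T)
  open import Data.Nat using (_+_)
  open import Data.Nat.Properties using (+-suc)
  open import Data.Nat.Divisibility using (_∣_; ∣-refl; ∣⇒≤; ∣m∣n⇒∣m+n; ∣m+n∣m⇒∣n)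

  odd : ℕ → Bool
  odd zero          = false
  odd (suc zero)    = true
  odd (suc (suc n)) = odd n

  odd-double : ∀ p → odd (p + p) ≡ false
  odd-double zero    = refl
  odd-double (suc p) rewrite +-suc p p = odd-double p

  odd-suc-double : ∀ p → odd (suc (p + p)) ≡ true
  odd-suc-double zero    = refl
  odd-suc-double (suc p) rewrite +-suc p p = odd-suc-double p

  2∣suc⇒odd : ∀ y → 2 ∣ suc y → T (odd y)
  2∣suc⇒odd zero          2∣1 with ∣⇒≤ 2∣1
  ... | s≤s ()
  2∣suc⇒odd (suc zero)    _   = _
  2∣suc⇒odd (suc (suc y)) 2∣y+3 = 2∣suc⇒odd y (∣m+n∣m⇒∣n 2∣y+3 ∣-refl)

  odd⇒2∣suc : ∀ y → T (odd y) → 2 ∣ suc y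
  odd⇒2∣suc (suc zero)    _     = ∣-refl
  odd⇒2∣suc (suc (suc y)) odd-y = ∣m∣n⇒∣m+n ∣-refl (odd⇒2∣suc y odd-y)

module Admissible (N M : ℕ) (M≡ : M ≡ suc (N ℕ.+ N)) where

  open import Data.Bool using (Bool; true; false; _∧_; _∨_; not; T)
  open import Data.Bool.Properties using (∧-zeroʳ; T-∧; T-≡)
  open import Data.Empty using (⊥; ⊥-elim)
  open import Data.Nat using (_+_; _*_; _∸_; _≤ᵇ_; _<ᵇ_; _≡ᵇ_)
  open import Data.Nat.Properties
  open import Data.Vec using (Vec; []; _∷_)
  open import Data.Product using (_×_; _,_; proj₁; proj₂)
  open import Function using (Equivalence)
  open ≡ using (cong; cong₂; sym; trans; module ≡-Reasoning)
  open ≡-Reasoning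
  open RangeSum +-*-commutativeSemiring
  open Counting
  open Parity
  open Rows using (extendRow; extendRow-cong; extendRow-*; evenRow; oddRow)

  -- Points and values are 0-based as in Defs: position L is the point L + 1 and value x
  -- the value x + 1. So top is the value 2n − 1, evenTarget y says y + 1 ∈ {2, …, 2n − 2},
  -- and allowed L x collects the constraints on a single entry: excedance, image inside
  -- the targets, and the value 2n − 1 only at odd points (even L).
  top : ℕ
  top = N + N

  evenTarget : ℕ → Bool
  evenTarget y = odd y ∧ (y <ᵇ top)

  allowed : ℕ → ℕ → Bool
  allowed L x = (L ≤ᵇ x) ∧ (evenTarget x ∨ (not (odd L) ∧ (x ≡ᵇ top)))

  allowedFrom : ∀ {k} → ℕ → Vec (Fin M) k → Bool
  allowedFrom L []      = true
  allowedFrom L (x ∷ s) = allowed L (toℕ x) ∧ allowedFrom (suc L) s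

  occurs : ∀ {k} → ℕ → Vec (Fin M) k → Bool
  occurs y []      = false
  occurs y (x ∷ s) = (y ≡ᵇ toℕ x) ∨ occurs y s

  covered : ∀ {k} → Vec (Fin M) k → ℕ
  covered s = ∑< M (λ y → 𝟙 (evenTarget y ∧ occurs y s))

  profile : ∀ {k} → ℕ → Vec (Fin M) k → ℕ → ℕ
  profile L s d = 𝟙 (allowedFrom L s ∧ (covered s ≡ᵇ d))

  suffixCount : ℕ → ℕ → ℕ → ℕ
  suffixCount L k d = ∑ᵥ k (λ s → profile L s d)

  targetsFrom : ℕ → ℕ
  targetsFrom L = ∑< M (λ y → 𝟙 ((L ≤ᵇ y) ∧ evenTarget y))

  topAllowed : ℕ → ℕ
  topAllowed L = 𝟙 ((L ≤ᵇ top) ∧ not (odd L))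

  top<M : top < M
  top<M = ≤-reflexive (sym M≡)

  newTarget : ∀ {k} → Vec (Fin M) k → ℕ → Bool
  newTarget s y = evenTarget y ∧ not (occurs y s)

  allowedFrom-occurs : ∀ {k} L (s : Vec (Fin M) k) y → T (allowedFrom L s) → T (occurs y s) → L ≤ y
  allowedFrom-occurs L (x ∷ s) y ok occ with y ≡ᵇ toℕ x in y≡x
  ... | true  = ≡.subst (L ≤_) (sym (≡ᵇ⇒≡ y (toℕ x) (Equivalence.from T-≡ y≡x)))
                  (≤ᵇ⇒≤ L (toℕ x) (proj₁ (Equivalence.to T-∧ (proj₁ (Equivalence.to T-∧ ok)))))
  ... | false = ≤-trans (n≤1+n L) (allowedFrom-occurs (suc L) s y (proj₂ (Equivalence.to T-∧ ok)) occ)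

  covered-cons : ∀ {k} (x : Fin M) (s : Vec (Fin M) k) → covered (x ∷ s) ≡ covered s + 𝟙 (newTarget s (toℕ x))
  covered-cons x s = begin
    ∑< M (λ y → 𝟙 (evenTarget y ∧ ((y ≡ᵇ toℕ x) ∨ occurs y s)))
      ≡⟨ ∑<-cong M (λ {y} _ → trans (split (evenTarget y) (y ≡ᵇ toℕ x) (occurs y s))
                                    (cong (𝟙 (evenTarget y ∧ occurs y s) +_) (𝟙≡ᵇ-transport y (toℕ x) (λ z → 𝟙 (newTarget s z))))) ⟩
    ∑< M (λ y → 𝟙 (evenTarget y ∧ occurs y s) + 𝟙 (y ≡ᵇ toℕ x) * 𝟙 (newTarget s (toℕ x)))
      ≡⟨ ∑<-distrib-+ M (λ y → 𝟙 (evenTarget y ∧ occurs y s)) (λ y → 𝟙 (y ≡ᵇ toℕ x) * 𝟙 (newTarget s (toℕ x))) ⟩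
    covered s + ∑< M (λ y → 𝟙 (y ≡ᵇ toℕ x) * 𝟙 (newTarget s (toℕ x)))
      ≡⟨ cong (covered s +_) (∑<-𝟙≡ᵇ (toℕ<n x) (λ _ → 𝟙 (newTarget s (toℕ x)))) ⟩
    covered s + 𝟙 (newTarget s (toℕ x)) ∎
    where
    split : ∀ g t o → 𝟙 (g ∧ (t ∨ o)) ≡ 𝟙 (g ∧ o) + 𝟙 t * 𝟙 (g ∧ not o)
    split false true  _     = refl
    split false false _     = refl
    split true  true  true  = refl
    split true  true  false = refl
    split true  false true  = refl
    split true  false false = refl

  new-choices : ∀ {k} L (s : Vec (Fin M) k) → T (allowedFrom (suc L) s) →
    ∑< M (λ y → 𝟙 (allowed L y ∧ newTarget s y)) + covered s ≡ targetsFrom L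
  new-choices L s ok = begin
    ∑< M (λ y → 𝟙 (allowed L y ∧ newTarget s y)) + covered s
      ≡⟨ ∑<-distrib-+ M (λ y → 𝟙 (allowed L y ∧ newTarget s y)) (λ y → 𝟙 (evenTarget y ∧ occurs y s)) ⟨
    ∑< M (λ y → 𝟙 (allowed L y ∧ newTarget s y) + 𝟙 (evenTarget y ∧ occurs y s))
      ≡⟨ ∑<-cong M (λ {y} _ → count (L ≤ᵇ y) (evenTarget y) (occurs y s) (not (odd L) ∧ (y ≡ᵇ top))
                                   (λ occ → ≤⇒≤ᵇ (≤-trans (n≤1+n L) (allowedFrom-occurs (suc L) s y ok occ)))) ⟩
    targetsFrom L ∎
    where
    count : ∀ l a o q → (T o → T l) →
      𝟙 ((l ∧ (a ∨ q)) ∧ (a ∧ not o)) + 𝟙 (a ∧ o) ≡ 𝟙 (l ∧ a)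
    count false a     true  q     o⇒l = ⊥-elim (o⇒l _)
    count false true  false q     _   = refl
    count false false false q     _   = refl
    count true  true  true  q     _   = refl
    count true  true  false q     _   = refl
    count true  false o     true  _   = refl
    count true  false o     false _   = refl

  evenTarget≢top : ∀ y → T (evenTarget y) → T (y ≡ᵇ top) → ⊥
  evenTarget≢top y target y≡top =
    <-irrefl (≡ᵇ⇒≡ y top y≡top) (<ᵇ⇒< y top (proj₂ (Equivalence.to T-∧ target)))

  all-choices : ∀ L → ∑< M (λ y → 𝟙 (allowed L y)) ≡ targetsFrom L + topAllowed L
  all-choices L = begin
    ∑< M (λ y → 𝟙 (allowed L y))
      ≡⟨ ∑<-cong M (λ {y} _ → count (L ≤ᵇ y) (evenTarget y) (not (odd L)) (y ≡ᵇ top) (evenTarget≢top y)) ⟩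
    ∑< M (λ y → 𝟙 ((L ≤ᵇ y) ∧ evenTarget y) + 𝟙 (y ≡ᵇ top) * 𝟙 ((L ≤ᵇ y) ∧ not (odd L)))
      ≡⟨ ∑<-distrib-+ M (λ y → 𝟙 ((L ≤ᵇ y) ∧ evenTarget y)) (λ y → 𝟙 (y ≡ᵇ top) * 𝟙 ((L ≤ᵇ y) ∧ not (odd L))) ⟩
    targetsFrom L + ∑< M (λ y → 𝟙 (y ≡ᵇ top) * 𝟙 ((L ≤ᵇ y) ∧ not (odd L)))
      ≡⟨ cong (targetsFrom L +_) (∑<-𝟙≡ᵇ top<M (λ y → 𝟙 ((L ≤ᵇ y) ∧ not (odd L)))) ⟩
    targetsFrom L + topAllowed L ∎
    where
    count : ∀ l a e t → (T a → T t → ⊥) → 𝟙 (l ∧ (a ∨ (e ∧ t))) ≡ 𝟙 (l ∧ a) + 𝟙 t * 𝟙 (l ∧ e)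
    count false a     e     true  _    = refl
    count false a     e     false _    = refl
    count true  true  e     true  excl = ⊥-elim (excl _ _)
    count true  true  true  false _    = refl
    count true  true  false false _    = refl
    count true  false true  true  _    = refl
    count true  false true  false _    = refl
    count true  false false true  _    = refl
    count true  false false false _    = refl

  old-choices : ∀ {k} L (s : Vec (Fin M) k) → T (allowedFrom (suc L) s) →
    ∑< M (λ y → 𝟙 (allowed L y ∧ not (newTarget s y))) ≡ topAllowed L + covered s
  old-choices L s ok = +-cancelˡ-≡ new _ _ (begin
    new + old
      ≡⟨ ∑<-distrib-+ M (λ y → 𝟙 (allowed L y ∧ newTarget s y)) (λ y → 𝟙 (allowed L y ∧ not (newTarget s y))) ⟨
    ∑< M (λ y → 𝟙 (allowed L y ∧ newTarget s y) + 𝟙 (allowed L y ∧ not (newTarget s y)))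
      ≡⟨ ∑<-cong M (λ {y} _ → 𝟙-split (allowed L y) (newTarget s y)) ⟨
    ∑< M (λ y → 𝟙 (allowed L y))
      ≡⟨ all-choices L ⟩
    targetsFrom L + topAllowed L
      ≡⟨ cong (_+ topAllowed L) (new-choices L s ok) ⟨
    new + covered s + topAllowed L
      ≡⟨ +-assoc new (covered s) (topAllowed L) ⟩
    new + (covered s + topAllowed L)
      ≡⟨ cong (new +_) (+-comm (covered s) (topAllowed L)) ⟩
    new + (topAllowed L + covered s) ∎)
    where
    new old : ℕ
    new = ∑< M (λ y → 𝟙 (allowed L y ∧ newTarget s y))
    old = ∑< M (λ y → 𝟙 (allowed L y ∧ not (newTarget s y)))

  extendRow-indicator : ∀ e a h d →
    extendRow e a (λ d → 𝟙 (h ≡ᵇ d)) d ≡ (a ∸ h) * 𝟙 (suc h ≡ᵇ d) + (e + h) * 𝟙 (h ≡ᵇ d)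
  extendRow-indicator e a zero    zero    = trans (+-identityʳ _) (sym (cong (_+ (e + 0) * 1) (*-zeroʳ a)))
  extendRow-indicator e a (suc h) zero    = trans (trans (+-identityʳ _) (*-zeroʳ (e + 0)))
    (sym (cong₂ _+_ (*-zeroʳ (a ∸ suc h)) (*-zeroʳ (e + suc h))))
  extendRow-indicator e a h       (suc d) = begin
    (e + suc d) * 𝟙 (h ≡ᵇ suc d) + (a ∸ d) * 𝟙 (h ≡ᵇ d)
      ≡⟨ +-comm ((e + suc d) * 𝟙 (h ≡ᵇ suc d)) _ ⟩
    (a ∸ d) * 𝟙 (h ≡ᵇ d) + (e + suc d) * 𝟙 (h ≡ᵇ suc d)
      ≡⟨ cong₂ _+_ (transport h d (a ∸_)) (transport h (suc d) (e +_)) ⟨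
    (a ∸ h) * 𝟙 (h ≡ᵇ d) + (e + h) * 𝟙 (h ≡ᵇ suc d) ∎
    where
    transport : ∀ y x (F : ℕ → ℕ) → F y * 𝟙 (y ≡ᵇ x) ≡ F x * 𝟙 (y ≡ᵇ x)
    transport y x F = trans (*-comm (F y) _) (trans (𝟙≡ᵇ-transport y x F) (*-comm _ (F x)))

  one-point-extensions : ∀ {k} L (s : Vec (Fin M) k) d → T (allowedFrom (suc L) s) →
    ∑[ x < M ] 𝟙 (allowed L (toℕ x) ∧ (covered (x ∷ s) ≡ᵇ d))
      ≡ extendRow (topAllowed L) (targetsFrom L) (λ d → 𝟙 (covered s ≡ᵇ d)) d
  one-point-extensions L s d ok = begin
    ∑[ x < M ] 𝟙 (allowed L (toℕ x) ∧ (covered (x ∷ s) ≡ᵇ d))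
      ≡⟨ sum-cong-≗ {M} (λ x → cong (λ c → 𝟙 (allowed L (toℕ x) ∧ (c ≡ᵇ d))) (covered-cons x s)) ⟩
    ∑< M (λ y → 𝟙 (allowed L y ∧ ((h + 𝟙 (newTarget s y)) ≡ᵇ d)))
      ≡⟨ ∑<-cong M (λ {y} _ → split (allowed L y) (newTarget s y)) ⟩
    ∑< M (λ y → 𝟙 (allowed L y ∧ newTarget s y) * 𝟙 (suc h ≡ᵇ d) + 𝟙 (allowed L y ∧ not (newTarget s y)) * 𝟙 (h ≡ᵇ d))
      ≡⟨ trans (∑<-distrib-+ M (λ y → 𝟙 (allowed L y ∧ newTarget s y) * 𝟙 (suc h ≡ᵇ d))
                                (λ y → 𝟙 (allowed L y ∧ not (newTarget s y)) * 𝟙 (h ≡ᵇ d)))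
               (sym (cong₂ _+_ (*-distribʳ-∑< M (𝟙 (suc h ≡ᵇ d)) (λ y → 𝟙 (allowed L y ∧ newTarget s y)))
                               (*-distribʳ-∑< M (𝟙 (h ≡ᵇ d)) (λ y → 𝟙 (allowed L y ∧ not (newTarget s y)))))) ⟩
    ∑< M (λ y → 𝟙 (allowed L y ∧ newTarget s y)) * 𝟙 (suc h ≡ᵇ d) + ∑< M (λ y → 𝟙 (allowed L y ∧ not (newTarget s y))) * 𝟙 (h ≡ᵇ d)
      ≡⟨ cong₂ (λ x y → x * 𝟙 (suc h ≡ᵇ d) + y * 𝟙 (h ≡ᵇ d)) new≡ (old-choices L s ok) ⟩
    (targetsFrom L ∸ h) * 𝟙 (suc h ≡ᵇ d) + (topAllowed L + h) * 𝟙 (h ≡ᵇ d)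
      ≡⟨ extendRow-indicator (topAllowed L) (targetsFrom L) h d ⟨
    extendRow (topAllowed L) (targetsFrom L) (λ d → 𝟙 (h ≡ᵇ d)) d ∎
    where
    h : ℕ
    h = covered s
    new≡ : ∑< M (λ y → 𝟙 (allowed L y ∧ newTarget s y)) ≡ targetsFrom L ∸ h
    new≡ = trans (sym (m+n∸n≡m _ h)) (cong (_∸ h) (new-choices L s ok))
    split : ∀ o nw → 𝟙 (o ∧ ((h + 𝟙 nw) ≡ᵇ d)) ≡ 𝟙 (o ∧ nw) * 𝟙 (suc h ≡ᵇ d) + 𝟙 (o ∧ not nw) * 𝟙 (h ≡ᵇ d)
    split false nw    = refl
    split true  true  = trans (cong (λ c → 𝟙 (c ≡ᵇ d)) (+-comm h 1)) (sym (trans (+-identityʳ _) (+-identityʳ _)))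
    split true  false = trans (cong (λ c → 𝟙 (c ≡ᵇ d)) (+-identityʳ h)) (sym (+-identityʳ _))

  ∑ᵥ-extendRow : ∀ e a k (F : Vec (Fin M) k → ℕ → ℕ) d →
    ∑ᵥ k (λ s → extendRow e a (F s) d) ≡ extendRow e a (λ d → ∑ᵥ k (λ s → F s d)) d
  ∑ᵥ-extendRow e a k F zero = begin
    ∑ᵥ k (λ s → (e + 0) * F s 0 + 0)   ≡⟨ ∑ᵥ-cong k (λ s → +-identityʳ _) ⟩
    ∑ᵥ k (λ s → (e + 0) * F s 0)       ≡⟨ ∑ᵥ-distribˡ-* k (e + 0) (λ s → F s 0) ⟩
    (e + 0) * ∑ᵥ k (λ s → F s 0)       ≡⟨ +-identityʳ _ ⟨
    (e + 0) * ∑ᵥ k (λ s → F s 0) + 0   ∎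
  ∑ᵥ-extendRow e a k F (suc d) = begin
    ∑ᵥ k (λ s → (e + suc d) * F s (suc d) + (a ∸ d) * F s d)
      ≡⟨ ∑ᵥ-distrib-+ k (λ s → (e + suc d) * F s (suc d)) (λ s → (a ∸ d) * F s d) ⟩
    ∑ᵥ k (λ s → (e + suc d) * F s (suc d)) + ∑ᵥ k (λ s → (a ∸ d) * F s d)
      ≡⟨ cong₂ _+_ (∑ᵥ-distribˡ-* k (e + suc d) (λ s → F s (suc d))) (∑ᵥ-distribˡ-* k (a ∸ d) (λ s → F s d)) ⟩
    (e + suc d) * ∑ᵥ k (λ s → F s (suc d)) + (a ∸ d) * ∑ᵥ k (λ s → F s d) ∎

  profile-cons : ∀ {k} L (s : Vec (Fin M) k) d →
    ∑[ x < M ] profile L (x ∷ s) d ≡ extendRow (topAllowed L) (targetsFrom L) (profile (suc L) s) d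
  profile-cons L s d = begin
    ∑[ x < M ] 𝟙 ((allowed L (toℕ x) ∧ ok) ∧ (covered (x ∷ s) ≡ᵇ d))
      ≡⟨ sum-cong-≗ {M} (λ x → pull (allowed L (toℕ x)) ok (covered (x ∷ s) ≡ᵇ d)) ⟩
    ∑[ x < M ] (𝟙 ok * 𝟙 (allowed L (toℕ x) ∧ (covered (x ∷ s) ≡ᵇ d)))
      ≡⟨ *-distribˡ-sum {M} (𝟙 ok) (λ x → 𝟙 (allowed L (toℕ x) ∧ (covered (x ∷ s) ≡ᵇ d))) ⟨
    𝟙 ok * ∑[ x < M ] 𝟙 (allowed L (toℕ x) ∧ (covered (x ∷ s) ≡ᵇ d))
      ≡⟨ 𝟙-*-cong ok (one-point-extensions L s d) ⟩
    𝟙 ok * extendRow (topAllowed L) (targetsFrom L) (λ d → 𝟙 (covered s ≡ᵇ d)) d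
      ≡⟨ extendRow-* (topAllowed L) (targetsFrom L) (𝟙 ok) (λ d → 𝟙 (covered s ≡ᵇ d)) d ⟨
    extendRow (topAllowed L) (targetsFrom L) (λ d → 𝟙 ok * 𝟙 (covered s ≡ᵇ d)) d
      ≡⟨ extendRow-cong (topAllowed L) (targetsFrom L) (λ d → 𝟙-∧ ok (covered s ≡ᵇ d)) d ⟨
    extendRow (topAllowed L) (targetsFrom L) (profile (suc L) s) d ∎
    where
    ok : Bool
    ok = allowedFrom (suc L) s
    pull : ∀ a b c → 𝟙 ((a ∧ b) ∧ c) ≡ 𝟙 b * 𝟙 (a ∧ c)
    pull false true  c = refl
    pull false false c = refl
    pull true  b     c = 𝟙-∧ b c

  suffixCount-suc : ∀ L k d →
    suffixCount L (suc k) d ≡ extendRow (topAllowed L) (targetsFrom L) (suffixCount (suc L) k) d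
  suffixCount-suc L k d = begin
    ∑[ x < M ] ∑ᵥ k (λ s → profile L (x ∷ s) d)
      ≡⟨ ∑ᵥ-comm k (λ x s → profile L (x ∷ s) d) ⟨
    ∑ᵥ k (λ s → ∑[ x < M ] profile L (x ∷ s) d)
      ≡⟨ ∑ᵥ-cong k (λ s → profile-cons L s d) ⟩
    ∑ᵥ k (λ s → extendRow (topAllowed L) (targetsFrom L) (profile (suc L) s) d)
      ≡⟨ ∑ᵥ-extendRow (topAllowed L) (targetsFrom L) k (profile (suc L)) d ⟩
    extendRow (topAllowed L) (targetsFrom L) (suffixCount (suc L) k) d ∎

  targetsFrom-step : ∀ L → L < M → targetsFrom L ≡ 𝟙 (evenTarget L) + targetsFrom (suc L)
  targetsFrom-step L L<M = begin
    targetsFrom L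
      ≡⟨ ∑<-cong M (λ {y} _ → peel L y evenTarget) ⟩
    ∑< M (λ y → 𝟙 (y ≡ᵇ L) * 𝟙 (evenTarget y) + 𝟙 ((suc L ≤ᵇ y) ∧ evenTarget y))
      ≡⟨ ∑<-distrib-+ M (λ y → 𝟙 (y ≡ᵇ L) * 𝟙 (evenTarget y)) (λ y → 𝟙 ((suc L ≤ᵇ y) ∧ evenTarget y)) ⟩
    ∑< M (λ y → 𝟙 (y ≡ᵇ L) * 𝟙 (evenTarget y)) + targetsFrom (suc L)
      ≡⟨ cong (_+ targetsFrom (suc L)) (∑<-𝟙≡ᵇ L<M (λ y → 𝟙 (evenTarget y))) ⟩
    𝟙 (evenTarget L) + targetsFrom (suc L) ∎
    where
    ≤ᵇ-suc : ∀ L y → (suc L ≤ᵇ suc y) ≡ (L ≤ᵇ y)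
    ≤ᵇ-suc zero    y = refl
    ≤ᵇ-suc (suc L) y = refl
    peel : ∀ L y (a : ℕ → Bool) → 𝟙 ((L ≤ᵇ y) ∧ a y) ≡ 𝟙 (y ≡ᵇ L) * 𝟙 (a y) + 𝟙 ((suc L ≤ᵇ y) ∧ a y)
    peel zero    zero    a = sym (trans (+-identityʳ _) (+-identityʳ _))
    peel zero    (suc y) a = refl
    peel (suc L) zero    a = refl
    peel (suc L) (suc y) a rewrite ≤ᵇ-suc L y | ≤ᵇ-suc (suc L) y = peel L y (λ k → a (suc k))

  targetsFrom-vanishes : ∀ L → top ≤ L → targetsFrom L ≡ 0
  targetsFrom-vanishes L top≤L = trans (∑<-cong M (λ {y} _ → 𝟙-false (beyond y))) (sum-replicate-zero M)
    where
    beyond : ∀ y → T ((L ≤ᵇ y) ∧ evenTarget y) → ⊥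
    beyond y t with Equivalence.to T-∧ t
    ... | L≤y , target = <⇒≱ (<ᵇ⇒< y top (proj₂ (Equivalence.to T-∧ target))) (≤-trans top≤L (≤ᵇ⇒≤ L y L≤y))

  targetsFrom-double : ∀ i p → p + i ≡ N → targetsFrom (p + p) ≡ i × targetsFrom (suc (p + p)) ≡ i
  targetsFrom-double zero    p p+0≡N =
    targetsFrom-vanishes (p + p) top≤ , targetsFrom-vanishes (suc (p + p)) (≤-trans top≤ (n≤1+n (p + p)))
    where
    top≤ : top ≤ p + p
    top≤ = ≤-reflexive (cong (λ n → n + n) (trans (sym p+0≡N) (+-identityʳ p)))
  targetsFrom-double (suc i) p p+1+i≡N = at-even , at-odd
    where
    below-top : suc (p + p) < top
    below-top = ≡.subst (λ n → suc (p + p) < n + n) p+1+i≡N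
      (≤-trans (≤-reflexive (cong suc (sym (+-suc p p)))) (+-mono-≤ 1+p≤ 1+p≤))
      where
      1+p≤ : suc p ≤ p + suc i
      1+p≤ = ≤-trans (s≤s (m≤m+n p i)) (≤-reflexive (sym (+-suc p i)))
    next : targetsFrom (suc p + suc p) ≡ i × targetsFrom (suc (suc p + suc p)) ≡ i
    next = targetsFrom-double i (suc p) (trans (sym (+-suc p i)) p+1+i≡N)
    at-odd : targetsFrom (suc (p + p)) ≡ suc i
    at-odd = begin
      targetsFrom (suc (p + p))
        ≡⟨ targetsFrom-step (suc (p + p)) (<-trans below-top top<M) ⟩
      𝟙 (evenTarget (suc (p + p))) + targetsFrom (suc (suc (p + p)))
        ≡⟨ cong₂ _+_ (𝟙-true (Equivalence.from T-∧ (≡.subst T (sym (odd-suc-double p)) _ , <⇒<ᵇ below-top)))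
                     (cong targetsFrom (sym (+-suc (suc p) p))) ⟩
      1 + targetsFrom (suc p + suc p)
        ≡⟨ cong suc (proj₁ next) ⟩
      suc i ∎
    at-even : targetsFrom (p + p) ≡ suc i
    at-even = begin
      targetsFrom (p + p)
        ≡⟨ targetsFrom-step (p + p) (<-trans (n<1+n _) (<-trans below-top top<M)) ⟩
      𝟙 (evenTarget (p + p)) + targetsFrom (suc (p + p))
        ≡⟨ cong₂ _+_ (cong (λ b → 𝟙 (b ∧ (p + p <ᵇ top))) (odd-double p)) at-odd ⟩
      suc i ∎

  topAllowed-double : ∀ p → p ≤ N → topAllowed (p + p) ≡ 1
  topAllowed-double p p≤N =
    𝟙-true (Equivalence.from T-∧ (≤⇒≤ᵇ (+-mono-≤ p≤N p≤N) , ≡.subst (λ b → T (not b)) (sym (odd-double p)) _))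

  topAllowed-suc-double : ∀ p → topAllowed (suc (p + p)) ≡ 0
  topAllowed-suc-double p =
    𝟙-false (λ t → ≡.subst (λ b → T (not b)) (odd-suc-double p) (proj₂ (Equivalence.to T-∧ t)))

  covered-[] : covered [] ≡ 0
  covered-[] = trans (∑<-cong M (λ {y} _ → cong 𝟙 (∧-zeroʳ (evenTarget y)))) (sum-replicate-zero M)

  suffixCount-evenRow : ∀ i p → p + i ≡ N → ∀ d → suffixCount (suc (p + p)) (i + i) d ≡ evenRow i d
  suffixCount-oddRow  : ∀ i p → p + i ≡ N → ∀ d → suffixCount (p + p) (suc (i + i)) d ≡ oddRow i d

  suffixCount-oddRow i p p+i≡N d = begin
    suffixCount (p + p) (suc (i + i)) d
      ≡⟨ suffixCount-suc (p + p) (i + i) d ⟩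
    extendRow (topAllowed (p + p)) (targetsFrom (p + p)) (suffixCount (suc (p + p)) (i + i)) d
      ≡⟨ cong₂ (λ e a → extendRow e a (suffixCount (suc (p + p)) (i + i)) d)
               (topAllowed-double p (≡.subst (p ≤_) p+i≡N (m≤m+n p i))) (proj₁ (targetsFrom-double i p p+i≡N)) ⟩
    extendRow 1 i (suffixCount (suc (p + p)) (i + i)) d
      ≡⟨ extendRow-cong 1 i (suffixCount-evenRow i p p+i≡N) d ⟩
    oddRow i d ∎

  suffixCount-evenRow zero    p _ d = trans (cong (λ c → 𝟙 (c ≡ᵇ d)) covered-[]) (empty d)
    where
    empty : ∀ d → 𝟙 (0 ≡ᵇ d) ≡ evenRow 0 d
    empty zero    = refl
    empty (suc d) = refl
  suffixCount-evenRow (suc i) p p+1+i≡N d = begin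
    suffixCount (suc (p + p)) (suc i + suc i) d
      ≡⟨ cong (λ k → suffixCount (suc (p + p)) (suc k) d) (+-suc i i) ⟩
    suffixCount (suc (p + p)) (suc (suc (i + i))) d
      ≡⟨ suffixCount-suc (suc (p + p)) (suc (i + i)) d ⟩
    extendRow (topAllowed (suc (p + p))) (targetsFrom (suc (p + p))) (suffixCount (suc (suc (p + p))) (suc (i + i))) d
      ≡⟨ cong₂ (λ e a → extendRow e a (suffixCount (suc (suc (p + p))) (suc (i + i))) d)
               (topAllowed-suc-double p) (proj₂ (targetsFrom-double (suc i) p p+1+i≡N)) ⟩
    extendRow 0 (suc i) (suffixCount (suc (suc (p + p))) (suc (i + i))) d
      ≡⟨ extendRow-cong 0 (suc i) (λ d → trans (cong (λ L → suffixCount L (suc (i + i)) d) (sym (+-suc (suc p) p)))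
                                                (suffixCount-oddRow i (suc p) (trans (sym (+-suc p i)) p+1+i≡N) d)) d ⟩
    evenRow (suc i) d ∎

  suffixCount≡oddRow : suffixCount 0 M N ≡ oddRow N N
  suffixCount≡oddRow = trans (cong (λ k → suffixCount 0 k N) M≡) (suffixCount-oddRow N 0 refl N)

module Characterisation (N : ℕ) where

  open import Data.Bool using (true; false; _∧_; not; T)
  open import Data.Bool.Properties using (T-∧; T-∨)
  open import Data.Empty using (⊥; ⊥-elim)
  open import Data.Nat using (_+_; _*_; _∸_; _≡ᵇ_)
  open import Data.Nat.Properties
  open import Data.Nat.Divisibility using (_∣_)
  open import Data.Fin.Properties using (toℕ-injective; toℕ-fromℕ<)
  open import Data.Vec using (Vec; []; _∷_; lookup)
  open import Data.Product using (_×_; _,_; proj₁; proj₂; ∃)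
  open import Data.Sum using (_⊎_; inj₁; inj₂)
  open import Function using (_⇔_; mk⇔; Equivalence)
  open import Data.List using (length; filter)
  open import Data.List.Properties using (filter-≐)
  open import Relation.Nullary.Decidable using (T?)
  open import Defs using (m; Target; Good; good?; count; allVecs)
  open ≡ using (cong; sym; trans; subst)
  open RangeSum ℕₚ.+-*-commutativeSemiring
  open Counting
  open Parity
  open Rows using (oddRow)

  n : ℕ
  n = suc N

  m≡ : m n ≡ suc (N + N)
  m≡ = trans (+-suc N (N + 0)) (cong (λ k → suc (N + k)) (+-identityʳ N))

  M : ℕ
  M = m n

  open Admissible N M m≡

  2n∸2≡top : 2 * n ∸ 2 ≡ top
  2n∸2≡top = trans (cong (_∸ 1) (+-suc N (N + 0))) (cong (N +_) (+-identityʳ N))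

  evenTarget⇔ : ∀ y → T (evenTarget y) ⇔ (2 ∣ suc y × suc y ≤ 2 * n ∸ 2)
  evenTarget⇔ y = mk⇔
    (λ t → let odd-y , y<top = Equivalence.to T-∧ t in
       odd⇒2∣suc y odd-y , subst (suc y ≤_) (sym 2n∸2≡top) (<ᵇ⇒< y top y<top))
    (λ (2∣ , bound) → Equivalence.from T-∧ (2∣suc⇒odd y 2∣ , <⇒<ᵇ (subst (suc y ≤_) 2n∸2≡top bound)))

  T-not⇒¬T : ∀ {b} → T (not b) → T b → ⊥
  T-not⇒¬T {false} _ ()

  ¬T⇒T-not : ∀ {b} → (T b → ⊥) → T (not b)
  ¬T⇒T-not {false} _  = _
  ¬T⇒T-not {true}  ¬b = ¬b _

  allowed⇔ : ∀ i x → T (allowed i x) ⇔ (i ≤ x × (2 ∣ suc i → suc x ≤ 2 * n ∸ 2) × Target n (suc x))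
  allowed⇔ i x = mk⇔ to from
    where
    to : T (allowed i x) → i ≤ x × (2 ∣ suc i → suc x ≤ 2 * n ∸ 2) × Target n (suc x)
    to t with Equivalence.to T-∧ t
    ... | i≤ᵇx , choice with Equivalence.to T-∨ choice
    ...   | inj₁ target = ≤ᵇ⇒≤ i x i≤ᵇx , (λ _ → proj₂ target′) , inj₁ target′
      where
      target′ : 2 ∣ suc x × suc x ≤ 2 * n ∸ 2
      target′ = Equivalence.to (evenTarget⇔ x) target
    ...   | inj₂ at-top with Equivalence.to T-∧ at-top
    ...     | even-i , x≡ᵇtop =
      ≤ᵇ⇒≤ i x i≤ᵇx
      , (λ 2∣ → ⊥-elim (T-not⇒¬T even-i (2∣suc⇒odd i 2∣)))
      , inj₂ (trans (cong suc (≡ᵇ⇒≡ x top x≡ᵇtop)) (sym m≡))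
    from : i ≤ x × (2 ∣ suc i → suc x ≤ 2 * n ∸ 2) × Target n (suc x) → T (allowed i x)
    from (i≤x , bound , target) = Equivalence.from T-∧ (≤⇒≤ᵇ i≤x , Equivalence.from T-∨ (choice target))
      where
      choice : Target n (suc x) → T (evenTarget x) ⊎ T (not (odd i) ∧ (x ≡ᵇ top))
      choice (inj₁ even-value) = inj₁ (Equivalence.from (evenTarget⇔ x) even-value)
      choice (inj₂ x+1≡2n-1)   = inj₂ (Equivalence.from T-∧ (¬T⇒T-not odd-i-impossible , ≡⇒≡ᵇ x top x≡top))
        where
        x≡top : x ≡ top
        x≡top = suc-injective (trans x+1≡2n-1 m≡)
        odd-i-impossible : T (odd i) → ⊥
        odd-i-impossible odd-i = <-irrefl x≡top (subst (suc x ≤_) 2n∸2≡top (bound (odd⇒2∣suc i odd-i)))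

  allowedFrom⇔ : ∀ {k} L (v : Vec (Fin M) k) →
    T (allowedFrom L v) ⇔ (∀ i → T (allowed (L + toℕ i) (toℕ (lookup v i))))
  allowedFrom⇔ L v = mk⇔ (to L v) (from L v)
    where
    at : ∀ {p q} → p ≡ q → ∀ x → T (allowed p x) → T (allowed q x)
    at p≡q x = subst (λ p → T (allowed p x)) p≡q
    to : ∀ {k} L (v : Vec (Fin M) k) → T (allowedFrom L v) → ∀ i → T (allowed (L + toℕ i) (toℕ (lookup v i)))
    to L (x ∷ s) ok Fin.zero    = at (sym (+-identityʳ L)) (toℕ x) (proj₁ (Equivalence.to T-∧ ok))
    to L (x ∷ s) ok (Fin.suc i) = at (sym (+-suc L (toℕ i))) (toℕ (lookup s i)) (to (suc L) s (proj₂ (Equivalence.to T-∧ ok)) i)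
    from : ∀ {k} L (v : Vec (Fin M) k) → (∀ i → T (allowed (L + toℕ i) (toℕ (lookup v i)))) → T (allowedFrom L v)
    from L []      _  = _
    from L (x ∷ s) ok = Equivalence.from T-∧
      (at (+-identityʳ L) (toℕ x) (ok Fin.zero) , from (suc L) s (λ i → at (+-suc L (toℕ i)) (toℕ (lookup s i)) (ok (Fin.suc i))))

  occurs⇔ : ∀ {k} y (v : Vec (Fin M) k) → T (occurs y v) ⇔ ∃ (λ i → toℕ (lookup v i) ≡ y)
  occurs⇔ y v = mk⇔ (to v) (from v)
    where
    to : ∀ {k} (v : Vec (Fin M) k) → T (occurs y v) → ∃ (λ i → toℕ (lookup v i) ≡ y)
    to (x ∷ s) occ with Equivalence.to T-∨ occ
    ... | inj₁ y≡ᵇx = Fin.zero , sym (≡ᵇ⇒≡ y (toℕ x) y≡ᵇx)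
    ... | inj₂ later = let i , eq = to s later in Fin.suc i , eq
    from : ∀ {k} (v : Vec (Fin M) k) → ∃ (λ i → toℕ (lookup v i) ≡ y) → T (occurs y v)
    from (x ∷ s) (Fin.zero  , eq) = Equivalence.from T-∨ (inj₁ (≡⇒≡ᵇ y (toℕ x) (sym eq)))
    from (x ∷ s) (Fin.suc i , eq) = Equivalence.from T-∨ (inj₂ (from s (i , eq)))

  covered⇔ : (v : Vec (Fin M) M) → covered v ≡ N ⇔ (∀ y → y < M → T (evenTarget y) → T (occurs y v))
  covered⇔ v = mk⇔ to from
    where
    uncovered : ℕ
    uncovered = ∑< M (λ y → 𝟙 (evenTarget y ∧ not (occurs y v)))
    covered+uncovered : covered v + uncovered ≡ N
    covered+uncovered = begin
      covered v + uncovered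
        ≡⟨ ∑<-distrib-+ M (λ y → 𝟙 (evenTarget y ∧ occurs y v)) (λ y → 𝟙 (evenTarget y ∧ not (occurs y v))) ⟨
      ∑< M (λ y → 𝟙 (evenTarget y ∧ occurs y v) + 𝟙 (evenTarget y ∧ not (occurs y v)))
        ≡⟨ ∑<-cong M (λ {y} _ → 𝟙-split (evenTarget y) (occurs y v)) ⟨
      targetsFrom 0
        ≡⟨ proj₁ (targetsFrom-double N 0 refl) ⟩
      N ∎
      where open ≡.≡-Reasoning
    hit : ∀ a o → T a → 𝟙 (a ∧ not o) ≡ 0 → T o
    hit true true  _ _ = _
    hit true false _ ()
    miss : ∀ a o → (T a → T o) → 𝟙 (a ∧ not o) ≡ 0
    miss false o     _     = refl
    miss true  true  _     = refl
    miss true  false a⇒o = ⊥-elim (a⇒o _)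
    to : covered v ≡ N → ∀ y → y < M → T (evenTarget y) → T (occurs y v)
    to covered≡N y y<M target = hit (evenTarget y) (occurs y v) target
      (∑<-vanishing-terms M (λ y → 𝟙 (evenTarget y ∧ not (occurs y v)))
        (+-cancelˡ-≡ (covered v) _ _ (trans covered+uncovered (trans (sym covered≡N) (sym (+-identityʳ (covered v)))))) y<M)
    from : (∀ y → y < M → T (evenTarget y) → T (occurs y v)) → covered v ≡ N
    from all-hit = trans (sym (+-identityʳ (covered v)))
      (trans (cong (covered v +_) (sym uncovered≡0)) covered+uncovered)
      where
      uncovered≡0 : uncovered ≡ 0
      uncovered≡0 = trans (∑<-cong M (λ {y} y<M → miss (evenTarget y) (occurs y v) (all-hit y y<M))) (sum-replicate-zero M)

  good⇔ : (v : Vec (Fin M) M) → Good n v ⇔ T (allowedFrom 0 v ∧ (covered v ≡ᵇ N))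
  good⇔ v = mk⇔ to from
    where
    to : Good n v → T (allowedFrom 0 v ∧ (covered v ≡ᵇ N))
    to (excedant , even-bound , image) = Equivalence.from T-∧ (all-allowed , ≡⇒≡ᵇ (covered v) N all-covered)
      where
      all-allowed : T (allowedFrom 0 v)
      all-allowed = Equivalence.from (allowedFrom⇔ 0 v) (λ i →
        Equivalence.from (allowed⇔ (toℕ i) (toℕ (lookup v i)))
          (s≤s⁻¹ (excedant i) , even-bound i , proj₁ (image (lookup v i)) (i , refl)))
      all-covered : covered v ≡ N
      all-covered = Equivalence.from (covered⇔ v) (λ y y<M target →
        let i , vᵢ≡y = proj₂ (image (Fin.fromℕ< y<M))
                         (inj₁ (subst (λ k → 2 ∣ suc k × suc k ≤ 2 * n ∸ 2) (sym (toℕ-fromℕ< y<M))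
                                      (Equivalence.to (evenTarget⇔ y) target)))
        in Equivalence.from (occurs⇔ y v) (i , trans (cong toℕ vᵢ≡y) (toℕ-fromℕ< y<M)))
    from : T (allowedFrom 0 v ∧ (covered v ≡ᵇ N)) → Good n v
    from t = (λ i → s≤s (proj₁ (entry i))) , (λ i → proj₁ (proj₂ (entry i))) , λ j → image-⊆ j , ⊆-image j
      where
      ok : T (allowedFrom 0 v)
      ok = proj₁ (Equivalence.to T-∧ t)
      covered≡N : covered v ≡ N
      covered≡N = ≡ᵇ⇒≡ (covered v) N (proj₂ (Equivalence.to T-∧ t))
      entry : ∀ i → toℕ i ≤ toℕ (lookup v i)
                  × (2 ∣ suc (toℕ i) → suc (toℕ (lookup v i)) ≤ 2 * n ∸ 2)
                  × Target n (suc (toℕ (lookup v i)))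
      entry i = Equivalence.to (allowed⇔ (toℕ i) (toℕ (lookup v i))) (Equivalence.to (allowedFrom⇔ 0 v) ok i)
      image-⊆ : ∀ j → ∃ (λ i → lookup v i ≡ j) → Target n (suc (toℕ j))
      image-⊆ j (i , refl) = proj₂ (proj₂ (entry i))
      ⊆-image : ∀ j → Target n (suc (toℕ j)) → ∃ (λ i → lookup v i ≡ j)
      ⊆-image j (inj₁ even-value) =
        let i , vᵢ≡j = Equivalence.to (occurs⇔ (toℕ j) v)
                         (Equivalence.to (covered⇔ v) covered≡N (toℕ j) (toℕ<n j) (Equivalence.from (evenTarget⇔ (toℕ j)) even-value))
        in i , toℕ-injective vᵢ≡j
      ⊆-image j (inj₂ j+1≡2n-1) = i₀ , toℕ-injective (trans v-at-top≡top (sym j≡top))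
        where
        -- by excedance the last point takes the value 2n − 1
        i₀ : Fin M
        i₀ = Fin.fromℕ< top<M
        j≡top : toℕ j ≡ top
        j≡top = suc-injective (trans j+1≡2n-1 m≡)
        v-at-top≡top : toℕ (lookup v i₀) ≡ top
        v-at-top≡top = ≤-antisym (s≤s⁻¹ (subst (toℕ (lookup v i₀) <_) m≡ (toℕ<n (lookup v i₀))))
                                 (subst (_≤ toℕ (lookup v i₀)) (toℕ-fromℕ< top<M) (proj₁ (entry i₀)))

  count≡oddRow : count n ≡ oddRow N N
  count≡oddRow = begin
    length (filter (good? n) (allVecs M))
      ≡⟨ cong length (filter-≐ (good? n) (λ v → T? (allowedFrom 0 v ∧ (covered v ≡ᵇ N)))
                               ((λ {v} → Equivalence.to (good⇔ v)) , (λ {v} → Equivalence.from (good⇔ v))) (allVecs M)) ⟩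
    length (filter (λ v → T? (allowedFrom 0 v ∧ (covered v ≡ᵇ N))) (allVecs M))
      ≡⟨ length-filter-allVecs M (λ v → T? (allowedFrom 0 v ∧ (covered v ≡ᵇ N))) ⟩
    suffixCount 0 M N
      ≡⟨ suffixCount≡oddRow ⟩
    oddRow N N ∎
    where open ≡.≡-Reasoning

open import Data.Integer using (+_)
open import Defs using (count)
open Rows using (oddRow)
open Inversion using (oddRow-diagonal≡H)
open Characterisation using (count≡oddRow)

corollary7p2 : (n : ℕ) → 1 ≤ n → H n ≡ + count n
corollary7p2 (suc N) _ = begin
  H (suc N)        ≡⟨ oddRow-diagonal≡H N ⟨
  + oddRow N N     ≡⟨ ≡.cong +_ (count≡oddRow N) ⟨
  + count (suc N)  ∎
  where open ≡.≡-Reasoning
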